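{- Run the multi-commodity procedure described in the context on a $k$-commodity source function $b\in\mathbb{R}^{V\times[k]}$, and suppose that at some round $i$ we have $\sum_{v\in V}\sum_{j\in[k]}\tilde\phi^i_{v,j}b_j(v)>\sum_{v\in V}\sum_{j\in[k]}\tilde\phi^i_{v,j}(Bf^i_j)_v$. Then $b$ is infeasible, i.e., there is no $k$-commodity flow $f\in\mathbb{R}^{E\times[k]}$ with $\sum_{j\in[k]}|f_j(e)|\le1$ for all $e\in E$ and $Bf_j=b_j$ for all $j\in[k]$.
   Context: $G=(V,E)$ is a unit-capacity undirected graph with $n=|V|$, each edge with a fixed arbitrary orientation $(u,v)$; $\deg(v)$ is the degree of $v$. The incidence matrix $B\in\mathbb{R}^{V\times E}$ has, in column $(u,v)$, entry $+1$ at row $u$, $-1$ at row $v$, $0$ elsewhere. $b_j$ denotes column $j$ of $b$. Multi-commodity procedure: given $b\in\mathbb{R}^{V\times[k]}$, $\alpha\le1/4$ and a number of rounds $T$, initialize $w^1_{v,j,+}=w^1_{v,j,- }=1$ for all $v\in V$, $j\in[k]$. In round $i=1,\dots,T$: (a) set $\tilde w^i_{v,j,\pm}=w^i_{v,j,\pm}$ if $w^i_{v,j,\pm}\ge n$ and $0$ otherwise; (b) set $\tilde\phi^i_{v,j}=(\tilde w^i_{v,j,+}-\tilde w^i_{v,j,- })/\deg(v)$; (c) define $f^i\in\mathbb{R}^{E\times[k]}$: for each edge $(u,v)$, let $j^*\in[k]$ maximize $|\tilde\phi^i_{u,j}-\tilde\phi^i_{v,j}|$ (ties arbitrary), set $f^i_{j^*}(u,v)=+1$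 if $\tilde\phi^i_{u,j^*}>\tilde\phi^i_{v,j^*}$, $-1$ if $\tilde\phi^i_{u,j^*}<\tilde\phi^i_{v,j^*}$, $0$ otherwise, and $f^i_j(u,v)=0$ for $j\ne j^*$; (d) if $\sum_{v,j}\tilde\phi^i_{v,j}b_j(v)>\sum_{v,j}\tilde\phi^i_{v,j}(Bf^i_j)_v$, terminate with $\tilde\phi^i$ as infeasibility certificate; (e) set $r^i_{v,j}=(b_j(v)-(Bf^i_j)_v)/\deg(v)$; (f) update $w^{i+1}_{v,j,+}=w^i_{v,j,+}(1+\alpha r^i_{v,j})$ and $w^{i+1}_{v,j,- }=w^i_{v,j,- }(1-\alpha r^i_{v,j})$.
   Formalization: The source function $b$ has rational entries instead of real ones, the parameter $\alpha$ is rational, and the $k$-commodity flows in the infeasibility claim are taken over ℚ. -}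

module Defs where

open import Data.Nat as ℕ using (ℕ; zero; suc)
open import Data.Integer using (+_; -[1+_])
open import Data.Fin using (Fin; zero; suc; _≟_)
open import Data.Rational using (ℚ; 0ℚ; 1ℚ; _+_; _-_; _*_; -_; _≤_; _<_; _/_; ∣_∣)
open import Data.Rational.Properties using (_≤?_; _<?_)
open import Data.Product using (Σ; _×_; ∃)
open import Relation.Binary.PropositionalEquality using (_≡_; _≢_)
open import Relation.Nullary using (¬_; yes; no)

∑ : {n : ℕ} → (Fin n → ℚ) → ℚ
∑ {zero}  f = 0ℚ
∑ {suc n} f = f zero + ∑ (λ i → f (suc i))

∑ℕ : {n : ℕ} → (Fin n → ℕ) → ℕ
∑ℕ {zero}  f = 0
∑ℕ {suc n} f = f zero ℕ.+ ∑ℕ (λ i → f (suc i))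

ℕ→ℚ : ℕ → ℚ
ℕ→ℚ a = + a / 1

record Graph (n m : ℕ) : Set where
  field
    src : Fin m → Fin n
    tgt : Fin m → Fin n

module _ {n m : ℕ} (G : Graph n m) where
  open Graph G

  [_≐_] : Fin n → Fin n → ℚ
  [ u ≐ v ] with u ≟ v
  ... | yes _ = 1ℚ
  ... | no  _ = 0ℚ

  [_≐_]ℕ : Fin n → Fin n → ℕ
  [ u ≐ v ]ℕ with u ≟ v
  ... | yes _ = 1
  ... | no  _ = 0

  deg : Fin n → ℕ
  deg v = ∑ℕ (λ e → [ src e ≐ v ]ℕ ℕ.+ [ tgt e ≐ v ]ℕ)

  -- 1 / deg(v)  (set to 0 when deg v = 0, which is excluded by hypothesis)
  invDeg : Fin n → ℚ
  invDeg v with deg v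
  ... | zero  = 0ℚ
  ... | suc d = + 1 / suc d

  Bmul : (Fin m → ℚ) → Fin n → ℚ
  Bmul g v = ∑ (λ e → ([ src e ≐ v ] - [ tgt e ≐ v ]) * g e)

-- k-commodity flows: f e j = f_j(e); sources b v j = b_j(v);
-- potentials φ v j = φ_{v,j}.
Flow : ℕ → ℕ → Set
Flow m k = Fin m → Fin k → ℚ

Demand : ℕ → ℕ → Set
Demand n k = Fin n → Fin k → ℚ

module _ {n m k : ℕ} (G : Graph n m) where
  open Graph G

  div : Flow m k → Demand n k
  div f v j = Bmul G (λ e → f e j) v

  Feasible : Demand n k → Set
  Feasible b = ∃ λ (f : Flow m k) →
    (∀ e → ∑ (λ j → ∣ f e j ∣) ≤ 1ℚ) × (∀ v j → div f v j ≡ b v j)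

  pairing : Demand n k → Demand n k → ℚ
  pairing φ x = ∑ (λ v → ∑ (λ j → φ v j * x v j))

  sgn : ℚ → ℚ
  sgn x with 0ℚ <? x
  ... | yes _ = 1ℚ
  ... | no _ with x <? 0ℚ
  ... | yes _ = - 1ℚ
  ... | no _  = 0ℚ

  -- step (c): f is a greedy flow w.r.t. potentials φ (ties broken arbitrarily)
  IsGreedy : Demand n k → Flow m k → Set
  IsGreedy φ f = ∀ e → Σ (Fin k) λ j* →
      (∀ j → ∣ φ (src e) j - φ (tgt e) j ∣ ≤ ∣ φ (src e) j* - φ (tgt e) j* ∣)
    × f e j* ≡ sgn (φ (src e) j* - φ (tgt e) j*)
    × (∀ j → j ≢ j* → f e j ≡ 0ℚ)

  -- The procedure, given the sequence of flows F chosen in each round.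
  -- Round index t : ℕ corresponds to round i = t + 1 of the paper.
  module Procedure (b : Demand n k) (α : ℚ) (F : ℕ → Flow m k) where

    r : ℕ → Demand n k
    r t v j = (b v j - div (F t) v j) * invDeg G v

    wplus wminus : ℕ → Demand n k
    wplus  zero    v j = 1ℚ
    wplus  (suc t) v j = wplus t v j * (1ℚ + α * r t v j)
    wminus zero    v j = 1ℚ
    wminus (suc t) v j = wminus t v j * (1ℚ - α * r t v j)

    thr : ℚ → ℚ
    thr w with ℕ→ℚ n ≤? w
    ... | yes _ = w
    ... | no  _ = 0ℚ

    φ̃ : ℕ → Demand n k
    φ̃ t v j = (thr (wplus t v j) - thr (wminus t v j)) * invDeg G v

    Terminates : ℕ → Set
    Terminates t = pairing (φ̃ t) (div (F t)) < pairing (φ̃ t) b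

    ValidRun : ℕ → Set
    ValidRun T = ∀ t → t ℕ.< T → IsGreedy (φ̃ t) (F t)

-- Weak duality. Pairing a potential φ with the divergence B f of a flow equals
-- pairing the gradient Bᵀφ with f edge by edge. On an edge, a flow of
-- congestion at most 1 gains at most max_j |(Bᵀφ)_j(e)|, which is exactly what
-- the greedy flow of step (c) gains. Hence every feasible b satisfies
-- ⟨φ, b⟩ ≤ ⟨φ, B f^i⟩ for the greedy f^i, whatever φ is, so the test of step (d)
-- can only fire when b is infeasible.
module Submission where

open import Defs
open import Algebra.Bundles using (Ring)
open import Data.Fin using (Fin; zero; suc; _≟_; punchIn)
open import Data.Fin.Properties using (punchInᵢ≢i)
open import Data.Integer using (+_)
open import Data.Nat using (ℕ; zero; suc; _<_)
open import Data.Nat.Properties using (n<1+n)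
open import Data.Product using (_,_)
open import Data.Rational using (ℚ; NonNegative; 0ℚ; 1ℚ; _+_; _-_; _*_; -_; ∣_∣; _≤_; _/_; _<?_; _≤?_)
  renaming (_<_ to _<ℚ_)
open import Data.Rational.Properties
  using ( +-*-ring; +-identityʳ; *-identityˡ; *-identityʳ; *-zeroˡ; *-zeroʳ; neg-distribʳ-*
        ; ≤-refl; ≤-reflexive; ≤-trans; ≤-antisym; <⇒≤; ≮⇒≥; ≰⇒>; <-irrefl; <-≤-trans
        ; module ≤-Reasoning; +-mono-≤; *-monoʳ-≤-nonNeg; *-monoˡ-≤-nonNeg; neg-antimono-≤
        ; 0≤∣p∣; 0≤p⇒∣p∣≡p; ∣-p∣≡∣p∣; ∣p*q∣≡∣p∣*∣q∣; ∣-∣-nonNeg )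
open import Data.Rational.Solver using (module +-*-Solver)
open import Function using (_∘_; flip)
open import Relation.Binary.PropositionalEquality
  using (_≡_; _≢_; refl; sym; trans; cong; cong₂; module ≡-Reasoning)
open import Relation.Nullary using (¬_; yes; no; contradiction)
import Algebra.Properties.Semiring.Sum (Ring.semiring +-*-ring) as Sum

open +-*-Solver

∑≡sum : ∀ {n} (f : Fin n → ℚ) → ∑ f ≡ Sum.sum f
∑≡sum {zero}  f = refl
∑≡sum {suc n} f = cong (λ s → f zero + s) (∑≡sum (f ∘ suc))

∑-cong : ∀ {n} {f g : Fin n → ℚ} → (∀ i → f i ≡ g i) → ∑ f ≡ ∑ g
∑-cong {f = f} {g} f≗g = trans (∑≡sum f) (trans (Sum.sum-cong-≗ f≗g) (sym (∑≡sum g)))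

∑-distrib-+ : ∀ {n} (f g : Fin n → ℚ) → ∑ (λ i → f i + g i) ≡ ∑ f + ∑ g
∑-distrib-+ f g = begin
  ∑ (λ i → f i + g i)           ≡⟨ ∑≡sum (λ i → f i + g i) ⟩
  Sum.sum (λ i → f i + g i)     ≡⟨ Sum.∑-distrib-+ f g ⟩
  Sum.sum f + Sum.sum g         ≡⟨ cong₂ _+_ (∑≡sum f) (∑≡sum g) ⟨
  ∑ f + ∑ g                     ∎
  where open ≡-Reasoning

*-distribˡ-∑ : ∀ {n} c (f : Fin n → ℚ) → c * ∑ f ≡ ∑ (λ i → c * f i)
*-distribˡ-∑ c f = begin
  c * ∑ f                       ≡⟨ cong (c *_) (∑≡sum f) ⟩
  c * Sum.sum f                 ≡⟨ Sum.*-distribˡ-sum c f ⟩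
  Sum.sum (λ i → c * f i)       ≡⟨ ∑≡sum (λ i → c * f i) ⟨
  ∑ (λ i → c * f i)             ∎
  where open ≡-Reasoning

∑-comm : ∀ {m n} (h : Fin m → Fin n → ℚ) →
         ∑ (λ i → ∑ (λ j → h i j)) ≡ ∑ (λ j → ∑ (λ i → h i j))
∑-comm h = begin
  ∑ (λ i → ∑ (h i))                   ≡⟨ ∑∑≡sumsum h ⟩
  Sum.sum (λ i → Sum.sum (h i))       ≡⟨ Sum.∑-comm h ⟩
  Sum.sum (λ j → Sum.sum (flip h j))  ≡⟨ ∑∑≡sumsum (flip h) ⟨
  ∑ (λ j → ∑ (flip h j))              ∎
  where
  open ≡-Reasoning
  ∑∑≡sumsum : ∀ {m n} (h : Fin m → Fin n → ℚ) →
              ∑ (λ i → ∑ (h i)) ≡ Sum.sum (λ i → Sum.sum (h i))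
  ∑∑≡sumsum h = trans (∑≡sum (λ i → ∑ (h i))) (Sum.sum-cong-≗ (∑≡sum ∘ h))

∑-supported-at : ∀ {n} (f : Fin n → ℚ) i → (∀ j → j ≢ i → f j ≡ 0ℚ) → ∑ f ≡ f i
∑-supported-at {suc n} f i vanishes = begin
  ∑ f                                 ≡⟨ ∑≡sum f ⟩
  Sum.sum f                           ≡⟨ Sum.sum-remove {i = i} f ⟩
  f i + Sum.sum (f ∘ punchIn i)       ≡⟨ cong (λ s → f i + s) rest≡0 ⟩
  f i + 0ℚ                            ≡⟨ +-identityʳ (f i) ⟩
  f i                                 ∎
  where
  open ≡-Reasoning
  rest≡0 : Sum.sum (f ∘ punchIn i) ≡ 0ℚ
  rest≡0 = trans (Sum.sum-cong-≗ (λ j → vanishes _ (punchInᵢ≢i i j))) (Sum.sum-replicate-zero n)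

∑-mono-≤ : ∀ {n} {f g : Fin n → ℚ} → (∀ i → f i ≤ g i) → ∑ f ≤ ∑ g
∑-mono-≤ {zero}  f≤g = ≤-refl
∑-mono-≤ {suc n} f≤g = +-mono-≤ (f≤g zero) (∑-mono-≤ (f≤g ∘ suc))

p≤∣p∣ : ∀ p → p ≤ ∣ p ∣
p≤∣p∣ p with 0ℚ ≤? p
... | yes 0≤p = ≤-reflexive (sym (0≤p⇒∣p∣≡p 0≤p))
... | no  0≰p = ≤-trans (<⇒≤ (≰⇒> 0≰p)) (0≤∣p∣ p)

∑x*y≤M*∑∣y∣ : ∀ {n} (x y : Fin n → ℚ) M → .{{_ : NonNegative M}} → (∀ i → ∣ x i ∣ ≤ M) →
              ∑ (λ i → x i * y i) ≤ M * ∑ (λ i → ∣ y i ∣)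
∑x*y≤M*∑∣y∣ x y M ∣x∣≤M =
  ≤-trans (∑-mono-≤ term≤) (≤-reflexive (sym (*-distribˡ-∑ M (λ i → ∣ y i ∣))))
  where
  term≤ : ∀ i → x i * y i ≤ M * ∣ y i ∣
  term≤ i = begin
    x i * y i          ≤⟨ p≤∣p∣ (x i * y i) ⟩
    ∣ x i * y i ∣      ≡⟨ ∣p*q∣≡∣p∣*∣q∣ (x i) (y i) ⟩
    ∣ x i ∣ * ∣ y i ∣  ≤⟨ *-monoʳ-≤-nonNeg ∣ y i ∣ {{∣-∣-nonNeg (y i)}} (∣x∣≤M i) ⟩
    M * ∣ y i ∣        ∎
    where open ≤-Reasoning

module _ {n m : ℕ} (G : Graph n m) where
  open Graph G

  ∑-indicator : ∀ u (c : Fin n → ℚ) → ∑ (λ v → [_≐_] G u v * c v) ≡ c u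
  ∑-indicator u c = trans (∑-supported-at (λ v → [_≐_] G u v * c v) u vanishes) at-u
    where
    vanishes : ∀ v → v ≢ u → [_≐_] G u v * c v ≡ 0ℚ
    vanishes v v≢u with u ≟ v
    ... | yes u≡v = contradiction (sym u≡v) v≢u
    ... | no  _   = *-zeroˡ (c v)
    at-u : [_≐_] G u u * c u ≡ c u
    at-u with u ≟ u
    ... | yes _   = *-identityˡ (c u)
    ... | no  u≢u = contradiction refl u≢u

  ∑-incidence : ∀ e (c : Fin n → ℚ) x →
    ∑ (λ v → c v * (([_≐_] G (src e) v - [_≐_] G (tgt e) v) * x)) ≡ (c (src e) - c (tgt e)) * x
  ∑-incidence e c x = begin
    ∑ (λ v → c v * ((S v - T v) * x))            ≡⟨ ∑-cong (λ v → split (S v) (T v) (c v) x) ⟩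
    ∑ (λ v → S v * a v + T v * - a v)            ≡⟨ ∑-distrib-+ (λ v → S v * a v) (λ v → T v * - a v) ⟩
    ∑ (λ v → S v * a v) + ∑ (λ v → T v * - a v)  ≡⟨ cong₂ _+_ (∑-indicator (src e) a)
                                                              (∑-indicator (tgt e) (λ v → - a v)) ⟩
    a (src e) + - a (tgt e)                      ≡⟨ merge (c (src e)) (c (tgt e)) x ⟩
    (c (src e) - c (tgt e)) * x                  ∎
    where
    open ≡-Reasoning
    S T a : Fin n → ℚ
    S = [_≐_] G (src e)
    T = [_≐_] G (tgt e)
    a v = c v * x
    split : ∀ s t a x → a * ((s - t) * x) ≡ s * (a * x) + t * - (a * x)
    split = solve 4 (λ s t a x → a :* ((s :- t) :* x) := s :* (a :* x) :+ t :* (:- (a :* x))) refl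
    merge : ∀ a b x → a * x + - (b * x) ≡ (a - b) * x
    merge = solve 3 (λ a b x → a :* x :+ (:- (b :* x)) := (a :- b) :* x) refl

module _ {n m k : ℕ} (G : Graph n m) where
  open Graph G

  grad : Demand n k → Flow m k
  grad φ e j = φ (src e) j - φ (tgt e) j

  edgePairing : Flow m k → Flow m k → ℚ
  edgePairing x f = ∑ (λ e → ∑ (λ j → x e j * f e j))

  pairing-div≡edgePairing-grad : ∀ φ f → pairing G φ (div G f) ≡ edgePairing (grad φ) f
  pairing-div≡edgePairing-grad φ f = begin
    ∑ (λ v → ∑ (λ j → φ v j * ∑ (λ e → D e v * f e j))) ≡⟨ ∑-cong (λ v → ∑-cong (λ j →
                                                             *-distribˡ-∑ (φ v j) (λ e → D e v * f e j))) ⟩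
    ∑ (λ v → ∑ (λ j → ∑ (λ e → h v j e)))              ≡⟨ ∑-cong (λ v → ∑-comm (h v)) ⟩
    ∑ (λ v → ∑ (λ e → ∑ (λ j → h v j e)))              ≡⟨ ∑-comm (λ v e → ∑ (λ j → h v j e)) ⟩
    ∑ (λ e → ∑ (λ v → ∑ (λ j → h v j e)))              ≡⟨ ∑-cong (λ e → ∑-comm (λ v j → h v j e)) ⟩
    ∑ (λ e → ∑ (λ j → ∑ (λ v → h v j e)))              ≡⟨ ∑-cong (λ e → ∑-cong (λ j →
                                                             ∑-incidence G e (λ v → φ v j) (f e j))) ⟩
    edgePairing (grad φ) f                              ∎
    where
    open ≡-Reasoning
    D : Fin m → Fin n → ℚ
    D e v = [_≐_] G (src e) v - [_≐_] G (tgt e) v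
    h : Fin n → Fin k → Fin m → ℚ
    h v j e = φ v j * (D e v * f e j)

  p*sgn[p]≡∣p∣ : ∀ p → p * sgn {k = k} G p ≡ ∣ p ∣
  p*sgn[p]≡∣p∣ p with 0ℚ <? p
  ... | yes 0<p = trans (*-identityʳ p) (sym (0≤p⇒∣p∣≡p (<⇒≤ 0<p)))
  ... | no  0≮p with p <? 0ℚ
  ...   | yes p<0 = begin
    p * - 1ℚ   ≡⟨ neg-distribʳ-* p 1ℚ ⟨
    - (p * 1ℚ) ≡⟨ cong -_ (*-identityʳ p) ⟩
    - p        ≡⟨ 0≤p⇒∣p∣≡p (neg-antimono-≤ (<⇒≤ p<0)) ⟨
    ∣ - p ∣    ≡⟨ ∣-p∣≡∣p∣ p ⟩
    ∣ p ∣      ∎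
    where open ≡-Reasoning
  ...   | no  p≮0 = trans (*-zeroʳ p) (cong ∣_∣ (sym p≡0))
    where
    p≡0 : p ≡ 0ℚ
    p≡0 = ≤-antisym (≮⇒≥ 0≮p) (≮⇒≥ p≮0)

  ∑-*-sgn-at : ∀ (x y : Fin k → ℚ) j* → y j* ≡ sgn {k = k} G (x j*) → (∀ j → j ≢ j* → y j ≡ 0ℚ) →
             ∑ (λ j → x j * y j) ≡ ∣ x j* ∣
  ∑-*-sgn-at x y j* y-at y-elsewhere = begin
    ∑ (λ j → x j * y j)          ≡⟨ ∑-supported-at (λ j → x j * y j) j* x*y-elsewhere ⟩
    x j* * y j*                  ≡⟨ cong (x j* *_) y-at ⟩
    x j* * sgn {k = k} G (x j*)  ≡⟨ p*sgn[p]≡∣p∣ (x j*) ⟩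
    ∣ x j* ∣                     ∎
    where
    open ≡-Reasoning
    x*y-elsewhere : ∀ j → j ≢ j* → x j * y j ≡ 0ℚ
    x*y-elsewhere j j≢j* = trans (cong (x j *_) (y-elsewhere j j≢j*)) (*-zeroʳ (x j))

  greedy-maximises-edgePairing : ∀ {φ g} f → IsGreedy G φ g → (∀ e → ∑ (λ j → ∣ f e j ∣) ≤ 1ℚ) →
                                 edgePairing (grad φ) f ≤ edgePairing (grad φ) g
  greedy-maximises-edgePairing {φ} {g} f greedy congestion≤1 = ∑-mono-≤ edge≤
    where
    edge≤ : ∀ e → ∑ (λ j → grad φ e j * f e j) ≤ ∑ (λ j → grad φ e j * g e j)
    edge≤ e with greedy e
    ... | j* , maximal , g-at , g-elsewhere = begin
      ∑ (λ j → grad φ e j * f e j)   ≤⟨ ∑x*y≤M*∑∣y∣ (grad φ e) (f e) M maximal ⟩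
      M * ∑ (λ j → ∣ f e j ∣)        ≤⟨ *-monoˡ-≤-nonNeg M (congestion≤1 e) ⟩
      M * 1ℚ                         ≡⟨ *-identityʳ M ⟩
      M                              ≡⟨ ∑-*-sgn-at (grad φ e) (g e) j* g-at g-elsewhere ⟨
      ∑ (λ j → grad φ e j * g e j)   ∎
      where
      open ≤-Reasoning
      M : ℚ
      M = ∣ grad φ e j* ∣
      instance
        M-nonNeg : NonNegative M
        M-nonNeg = ∣-∣-nonNeg (grad φ e j*)

  greedy-gap⇒¬Feasible : ∀ {φ g} b → IsGreedy G φ g →
                         pairing G φ (div G g) <ℚ pairing G φ b → ¬ Feasible G b
  greedy-gap⇒¬Feasible {φ} {g} b greedy greedy<b (f , congestion≤1 , routes-b) =
    <-irrefl refl (<-≤-trans greedy<b b≤greedy)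
    where
    b≤greedy : pairing G φ b ≤ pairing G φ (div G g)
    b≤greedy = begin
      pairing G φ b                ≡⟨ ∑-cong (λ v → ∑-cong (λ j → cong (φ v j *_) (sym (routes-b v j)))) ⟩
      pairing G φ (div G f)        ≡⟨ pairing-div≡edgePairing-grad φ f ⟩
      edgePairing (grad φ) f       ≤⟨ greedy-maximises-edgePairing {φ} f greedy congestion≤1 ⟩
      edgePairing (grad φ) g       ≡⟨ pairing-div≡edgePairing-grad φ g ⟨
      pairing G φ (div G g)        ∎
      where open ≤-Reasoning

-- Of the hypotheses only the greediness of round t matters: weak duality holds
-- for every potential.
lemma2p10 : (n m k : ℕ) (G : Graph n m)
    → (∀ e → Graph.src G e ≢ Graph.tgt G e)
    → (∀ v → 0 < deg G v)
    → (b : Demand n k) (α : ℚ) → α ≤ + 1 / 4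
    → (T : ℕ) (F : ℕ → Flow m k)
    → (t : ℕ) → t < T
    → Procedure.ValidRun G b α F (suc t)
    → (∀ s → s < t → ¬ Procedure.Terminates G b α F s)
    → Procedure.Terminates G b α F t
    → ¬ Feasible G b
lemma2p10 _ _ _ G _ _ b α _ _ F t _ valid _ terminates =
  greedy-gap⇒¬Feasible G {φ̃ t} {F t} b (valid t (n<1+n t)) terminates
  where open Procedure G b α F using (φ̃)
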